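{- The decycling numbers of the bubble-sort star graphs $BS_3$, $BS_4$, $BS_5$ are $D(3)=2$, $D(4)=10$ and $D(5)=51$.
   Context: For $n\geqslant 3$, the bubble-sort star graph $BS_n$ has as vertices the $n!$ permutations $(u_1u_2\ldots u_n)$ of $\{1,2,\ldots,n\}$. Let $\mathcal{T}=\{(1,2),(1,3),\ldots,(1,n),(2,3),(3,4),\ldots,(n-1,n)\}$. Two vertices are adjacent iff one is obtained from the other by swapping the entries in positions $i$ and $j$ for some $(i,j)\in\mathcal{T}$. A decycling set of a graph $G$ is a set $D$ of vertices such that $G\setminus D$ is acyclic; the decycling number is the minimum cardinality of a decycling set. $D(n)$ denotes the decycling number of $BS_n$. -}

module Defs where

open import Data.Nat using (ℕ; zero; suc; _≤_; _<_)
open import Data.Fin using (Fin; toℕ)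
open import Data.Vec using (Vec; lookup; _[_]≔_; toList)
open import Data.List using (List; []; _∷_; _++_; length)
open import Data.List.Relation.Unary.All using (All)
open import Data.List.Relation.Unary.Unique.Propositional using (Unique)
open import Data.List.Relation.Unary.Linked using (Linked)
open import Data.List.Membership.Propositional using (_∈_; _∉_)
open import Data.Product using (Σ; _×_; ∃)
open import Data.Sum using (_⊎_)
open import Relation.Binary.PropositionalEquality using (_≡_)
open import Relation.Nullary using (¬_)
open import Data.Empty using (⊥)

-- A vertex of BS_n: a permutation (u_1 ... u_n) of {1..n}, written as the
-- vector of its entries (0-indexed: entries and positions in Fin n),
-- required to have pairwise distinct entries.
Word : ℕ → Set
Word n = Vec (Fin n) n

IsPerm : {n : ℕ} → Word n → Set
IsPerm u = Unique (toList u)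

-- The transposition set T, 0-indexed:
--   (1,k), k ≥ 2   becomes  (0, j) with j ≥ 1
--   (i,i+1), i ≥ 2 becomes  (i, i+1) with i ≥ 1
InT : {n : ℕ} → Fin n → Fin n → Set
InT i j = (toℕ i ≡ 0 × 0 < toℕ j) ⊎ (1 ≤ toℕ i × toℕ j ≡ suc (toℕ i))

swap : {n : ℕ} → Fin n → Fin n → Word n → Word n
swap i j u = (u [ i ]≔ lookup u j) [ j ]≔ lookup u i

Adj : {n : ℕ} → Word n → Word n → Set
Adj {n} u v = Σ (Fin n) λ i → Σ (Fin n) λ j → InT i j × v ≡ swap i j u

IsCycle : {n : ℕ} → List (Word n) → Set
IsCycle [] = ⊥
IsCycle {n} (v ∷ vs) =
  All IsPerm (v ∷ vs) × Unique (v ∷ vs) × 3 ≤ length (v ∷ vs)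
  × Linked (Adj {n}) (v ∷ vs ++ v ∷ [])

IsDecyclingSet : (n : ℕ) → List (Word n) → Set
IsDecyclingSet n D = ∀ (c : List (Word n)) → IsCycle c → ¬ All (λ v → v ∉ D) c

IsVertexSet : (n : ℕ) → List (Word n) → Set
IsVertexSet n D = All IsPerm D × Unique D

DecyclingNumber : ℕ → ℕ → Set
DecyclingNumber n k =
  (Σ (List (Word n)) λ D → IsVertexSet n D × IsDecyclingSet n D × length D ≡ k)
  × (∀ (D : List (Word n)) → IsVertexSet n D → IsDecyclingSet n D → k ≤ length D)

module Submission where

-- BS_n is (2n−3)-regular on n! vertices.  For the upper bounds, the vertices outside the
-- exhibited set D are listed in an order in which every vertex has at most one neighbour
-- later in the list, so they induce a forest.  For the lower bounds, if |D| = x ≤ k then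
-- the remaining s vertices span at least (d·s − d·x)/2 ≥ s edges, and a finite graph with
-- at least as many edges as vertices contains a cycle: prune vertices of degree ≤ 1 (which
-- preserves that inequality) and walk in the remaining graph of minimum degree 2 until a
-- vertex repeats.

open import Defs
open import Data.Empty using (⊥; ⊥-elim)
open import Data.Fin as Fin using (Fin; toℕ)
open import Data.Fin.Patterns using (0F; 1F; 2F; 3F; 4F)
open import Data.List
  using (List; []; _∷_; _++_; length; filter; allFin; cartesianProduct; cartesianProductWith)
open import Data.List.Membership.Propositional using (_∈_; _∉_; find)
open import Data.List.Membership.Propositional.Properties
  using (∈-∃++; ∈-filter⁺; ∈-filter⁻; ∈-allFin; ∈-cartesianProduct⁺; ∈-cartesianProductWith⁺)
open import Data.List.Properties
  using (++-assoc; ++-identityʳ; length-++; filter-all; filter-notAll)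
open import Data.List.Relation.Binary.Permutation.Propositional using (_↭_; prep; ↭-trans)
open import Data.List.Relation.Binary.Permutation.Propositional.Properties
  using (All-resp-↭; shift; ++-comm)
open import Data.List.Relation.Unary.All as All using (All; []; _∷_; all?)
open import Data.List.Relation.Unary.All.Properties using (¬Any⇒All¬)
open import Data.List.Relation.Unary.Any as Any using (Any; here; there)
open import Data.List.Relation.Unary.Linked as Linked using (Linked; []; [-]; _∷_)
open import Data.List.Relation.Unary.Unique.DecPropositional using (unique?)
open import Data.List.Relation.Unary.Unique.Propositional using (Unique; []; _∷_)
open import Data.List.Relation.Unary.Unique.Propositional.Properties using (Unique[x∷xs]⇒x∉xs)
import Data.List.Relation.Unary.Unique.Propositional.Properties as Unique
open import Data.Nat as ℕ using (ℕ; zero; suc; _+_; _*_; _≤_; _<_; z≤n; s≤s; _≤?_; >-nonZero)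
open import Data.Nat.Properties
open import Algebra.Properties.CommutativeSemigroup +-commutativeSemigroup
  using (interchange; x∙yz≈y∙xz; xy∙z≈xz∙y)
open import Data.Product using (_×_; _,_; proj₁; proj₂; ∃-syntax; uncurry)
open import Data.Sum using (_⊎_; [_,_]′)
open import Data.Unit using (⊤; tt)
open import Data.Vec using (Vec; []; _∷_; lookup; _[_]≔_; toList; tabulate)
open import Data.Vec.Properties as Vec
  using (lookup∘update; lookup∘update′; tabulate∘lookup; tabulate-cong)
open import Function using (_∘_; id; flip)
open import Level using (0ℓ)
open import Relation.Binary using (Rel; Decidable; Symmetric; DecidableEquality)
open import Relation.Binary.PropositionalEquality
open import Relation.Nullary using (¬_; Dec; yes; no; ¬?; _×-dec_; _⊎-dec_; contradiction)
open import Relation.Nullary.Decidable using (from-yes)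
import Relation.Unary as U

leaf-bound : ∀ {s d a} → d ≤ 1 → suc s + suc s ≤ d + (d + a) → s + s ≤ a
leaf-bound {s} {zero}           _        h       = ≤-trans (+-monoʳ-≤ s (n≤1+n s)) (≤-trans (n≤1+n _) h)
leaf-bound {s} {suc zero}    {a} _        (s≤s h) = ≤-pred (subst (_≤ suc a) (+-suc s s) h)
leaf-bound {d = suc (suc _)}     (s≤s ()) _

complement-split : ∀ {s₀ k s x} → s + x ≡ s₀ + k → x ≤ k → ∃[ y ] k ≡ x + y × s ≡ s₀ + y
complement-split {s₀} {k} {s} {x} e x≤k =
  let y , x+y≡k = m≤n⇒∃[o]m+o≡n x≤k
  in y , sym x+y≡k , +-cancelʳ-≡ x s (s₀ + y) (begin
       s + x           ≡⟨ e ⟩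
       s₀ + k          ≡⟨ cong (s₀ +_) (trans (sym x+y≡k) (+-comm x y)) ⟩
       s₀ + (y + x)    ≡⟨ +-assoc s₀ y x ⟨
       s₀ + y + x      ∎)
  where open ≡-Reasoning

-- The density bound is monotone in x, so it suffices to check it at the extreme x = k.
dense-complement : ∀ {d s₀ k s x} → 1 ≤ d → 1 ≤ s₀ → s₀ + s₀ + d * k ≤ d * s₀ →
                   s + x ≡ s₀ + k → x ≤ k → 1 ≤ s × s + s + d * x ≤ d * s
dense-complement {d} {s₀} {k} {s} {x} d≥1 s₀≥1 dense e x≤k
  with complement-split {s₀} {k} {s} {x} e x≤k
... | y , refl , refl = ≤-trans s₀≥1 (m≤m+n s₀ y) , (begin
  s₀ + y + (s₀ + y) + d * x           ≡⟨ cong (_+ d * x) (interchange s₀ y s₀ y) ⟩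
  s₀ + s₀ + (y + y) + d * x           ≡⟨ xy∙z≈xz∙y (s₀ + s₀) (y + y) (d * x) ⟩
  s₀ + s₀ + d * x + (y + y)           ≤⟨ +-monoʳ-≤ (s₀ + s₀ + d * x) (+-mono-≤ y≤dy y≤dy) ⟩
  s₀ + s₀ + d * x + (d * y + d * y)   ≡⟨ +-assoc (s₀ + s₀ + d * x) (d * y) (d * y) ⟨
  s₀ + s₀ + d * x + d * y + d * y     ≡⟨ cong (_+ d * y) (trans (+-assoc (s₀ + s₀) (d * x) (d * y))
                                                  (cong (s₀ + s₀ +_) (sym (*-distribˡ-+ d x y)))) ⟩
  s₀ + s₀ + d * (x + y) + d * y       ≤⟨ +-monoˡ-≤ (d * y) dense ⟩
  d * s₀ + d * y                      ≡⟨ *-distribˡ-+ d s₀ y ⟨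
  d * (s₀ + y)                        ∎)
  where open ≤-Reasoning
        y≤dy : y ≤ d * y
        y≤dy = m≤n*m y d {{>-nonZero d≥1}}

module _ {A : Set} where

  ∑ : List A → (A → ℕ) → ℕ
  ∑ []       g = 0
  ∑ (x ∷ xs) g = g x + ∑ xs g

  ∑-cong : ∀ xs {g h} → (∀ {x} → x ∈ xs → g x ≡ h x) → ∑ xs g ≡ ∑ xs h
  ∑-cong []       _  = refl
  ∑-cong (x ∷ xs) eq = cong₂ _+_ (eq (here refl)) (∑-cong xs (eq ∘ there))

  ∑-+ : ∀ xs g h → ∑ xs (λ x → g x + h x) ≡ ∑ xs g + ∑ xs h
  ∑-+ []       g h = refl
  ∑-+ (x ∷ xs) g h =
    trans (cong (g x + h x +_) (∑-+ xs g h)) (interchange (g x) (h x) (∑ xs g) (∑ xs h))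

  ∑-const : ∀ xs c → ∑ xs (λ _ → c) ≡ c * length xs
  ∑-const []       c = sym (*-zeroʳ c)
  ∑-const (x ∷ xs) c = trans (cong (c +_) (∑-const xs c)) (sym (*-suc c (length xs)))

  ∑-comm : ∀ X Y (h : A → A → ℕ) → ∑ X (λ x → ∑ Y (h x)) ≡ ∑ Y (λ y → ∑ X λ x → h x y)
  ∑-comm []      Y h = sym (∑-const Y 0)
  ∑-comm (x ∷ X) Y h =
    trans (cong (∑ Y (h x) +_) (∑-comm X Y h)) (sym (∑-+ Y (h x) λ y → ∑ X λ x′ → h x′ y))

  ∑-partition : ∀ {P : A → Set} (P? : U.Decidable P) xs g →
                ∑ xs g ≡ ∑ (filter P? xs) g + ∑ (filter (¬? ∘ P?) xs) g
  ∑-partition P? []       g = refl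
  ∑-partition P? (x ∷ xs) g with P? x
  ... | yes _ = trans (cong (g x +_) (∑-partition P? xs g)) (sym (+-assoc (g x) _ _))
  ... | no  _ = trans (cong (g x +_) (∑-partition P? xs g))
                      (x∙yz≈y∙xz (g x) (∑ (filter P? xs) g) (∑ (filter (¬? ∘ P?) xs) g))

  length-partition : ∀ {P : A → Set} (P? : U.Decidable P) xs →
                     length xs ≡ length (filter P? xs) + length (filter (¬? ∘ P?) xs)
  length-partition P? []       = refl
  length-partition P? (x ∷ xs) with P? x
  ... | yes _ = cong suc (length-partition P? xs)
  ... | no  _ = trans (cong suc (length-partition P? xs)) (sym (+-suc _ _))

module Removal {A : Set} (_≟_ : DecidableEquality A) where

  remove : A → List A → List A
  remove v = filter (λ x → ¬? (x ≟ v))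

  ∈-remove⁺ : ∀ {v x xs} → x ∈ xs → x ≢ v → x ∈ remove v xs
  ∈-remove⁺ = ∈-filter⁺ (λ x → ¬? (x ≟ _))

  ∈-remove⁻ : ∀ {v x} xs → x ∈ remove v xs → x ∈ xs × x ≢ v
  ∈-remove⁻ xs = ∈-filter⁻ (λ x → ¬? (x ≟ _)) {xs = xs}

  length-remove< : ∀ {v xs} → v ∈ xs → length (remove v xs) < length xs
  length-remove< {v} {xs} v∈xs =
    filter-notAll (λ x → ¬? (x ≟ v)) xs (Any.map (λ { refl x≢x → x≢x refl }) v∈xs)

  ∑-remove : ∀ {v xs} → Unique xs → v ∈ xs → ∀ g → ∑ xs g ≡ g v + ∑ (remove v xs) g
  ∑-remove {v} {x ∷ xs} (x≢ ∷ unique) v∈ g with x ≟ v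
  ... | yes refl = cong (λ ys → g x + ∑ ys g) (sym (filter-all (λ y → ¬? (y ≟ x)) (All.map ≢-sym x≢)))
  ∑-remove {v} {x ∷ xs} (x≢ ∷ unique) (here refl)  g | no x≢v = ⊥-elim (x≢v refl)
  ∑-remove {v} {x ∷ xs} (x≢ ∷ unique) (there v∈) g | no x≢v =
    trans (cong (g x +_) (∑-remove unique v∈ g)) (x∙yz≈y∙xz (g x) (g v) _)

  unique-⊆⇒length≤ : ∀ {xs ys} → Unique xs → All (_∈ ys) xs → length xs ≤ length ys
  unique-⊆⇒length≤ {[]}     _              _               = z≤n
  unique-⊆⇒length≤ {x ∷ xs} {ys} (x≢ ∷ unique) (x∈ys ∷ xs⊆ys) =
    ≤-trans (s≤s (unique-⊆⇒length≤ unique xs⊆ys-x)) (length-remove< x∈ys)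
    where
    xs⊆ys-x : All (_∈ remove x ys) xs
    xs⊆ys-x = All.zipWith (λ (x≢y , y∈ys) → ∈-remove⁺ y∈ys (≢-sym x≢y)) (x≢ , xs⊆ys)

module FiniteGraph {A : Set} (_≟_ : DecidableEquality A)
                   {_~_ : Rel A 0ℓ} (_~?_ : Decidable _~_) (~-sym : Symmetric _~_) where

  open import Data.List.Membership.DecPropositional _≟_ using (_∈?_; _∉?_)
  open Removal _≟_

  Cycle : List A → Set
  Cycle []       = ⊥
  Cycle (v ∷ vs) = Unique (v ∷ vs) × 3 ≤ length (v ∷ vs) × Linked _~_ (v ∷ vs ++ v ∷ [])

  CycleIn : List A → Set
  CycleIn S = ∃[ c ] Cycle c × All (_∈ S) c

  Unique-∷ʳ : ∀ {xs : List A} {v} → Unique xs → v ∉ xs → Unique (xs ++ v ∷ [])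
  Unique-∷ʳ {xs} {v} unique v∉xs =
    Unique.++⁺ {xs = xs} {ys = v ∷ []} unique ([] ∷ []) λ { (v∈xs , here refl) → v∉xs v∈xs }

  Linked-∷ʳ : ∀ xs {y z} → Linked _~_ (xs ++ y ∷ []) → y ~ z → Linked _~_ (xs ++ y ∷ z ∷ [])
  Linked-∷ʳ []            [-]          y~z = y~z ∷ [-]
  Linked-∷ʳ (x ∷ [])      (x~y ∷ [-])  y~z = x~y ∷ y~z ∷ [-]
  Linked-∷ʳ (x ∷ x′ ∷ xs) (x~x′ ∷ lnk) y~z = x~x′ ∷ Linked-∷ʳ (x′ ∷ xs) lnk y~z

  Linked-last : ∀ y ys {z} → Linked _~_ (y ∷ ys ++ z ∷ []) → ∃[ b ] b ∈ y ∷ ys × b ~ z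
  Linked-last y []        (y~z ∷ [-]) = y , here refl , y~z
  Linked-last y (y′ ∷ ys) (_ ∷ lnk)   =
    let b , b∈ , b~z = Linked-last y′ ys lnk in b , there b∈ , b~z

  Cycle-rotate : ∀ v vs → Cycle (v ∷ vs) → Cycle (vs ++ v ∷ [])
  Cycle-rotate v []       (_ , s≤s () , _)
  Cycle-rotate v (w ∷ ws) (unique@(_ ∷ unique′) , len , v~w ∷ lnk) =
    Unique-∷ʳ unique′ (Unique[x∷xs]⇒x∉xs unique) ,
    ≤-trans len (≤-reflexive (cong suc (sym (trans (length-++ ws) (+-comm (length ws) 1))))) ,
    subst (λ ys → Linked _~_ (w ∷ ys)) (sym (++-assoc ws (v ∷ []) (w ∷ [])))
      (Linked-∷ʳ (w ∷ ws) lnk v~w)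

  Cycle-rotate-to : ∀ pre x post → Cycle (pre ++ x ∷ post) → Cycle (x ∷ post ++ pre)
  Cycle-rotate-to []        x post cyc = subst (λ ys → Cycle (x ∷ ys)) (sym (++-identityʳ post)) cyc
  Cycle-rotate-to (p ∷ pre) x post cyc =
    subst (λ ys → Cycle (x ∷ ys)) (++-assoc post (p ∷ []) pre)
      (Cycle-rotate-to pre x (post ++ p ∷ [])
        (subst Cycle (++-assoc pre (x ∷ post) (p ∷ [])) (Cycle-rotate p (pre ++ x ∷ post) cyc)))

  rotation-↭ : ∀ pre (x : A) post → pre ++ x ∷ post ↭ x ∷ post ++ pre
  rotation-↭ pre x post = ↭-trans (shift x pre post) (prep x (++-comm pre post))

  edge : A → A → ℕ
  edge u v with u ~? v
  ... | yes _ = 1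
  ... | no  _ = 0

  edge-sym : ∀ u v → edge u v ≡ edge v u
  edge-sym u v with u ~? v | v ~? u
  ... | yes _   | yes _   = refl
  ... | no  _   | no  _   = refl
  ... | yes u~v | no ¬v~u = ⊥-elim (¬v~u (~-sym u~v))
  ... | no ¬u~v | yes v~u = ⊥-elim (¬u~v (~-sym v~u))

  edge≤1 : ∀ u v → edge u v ≤ 1
  edge≤1 u v with u ~? v
  ... | yes _ = ≤-refl
  ... | no  _ = z≤n

  degree : A → List A → ℕ
  degree v S = ∑ S (edge v)

  arcs : List A → List A → ℕ
  arcs X Y = ∑ X λ u → degree u Y

  degree-≥1 : ∀ {v a S} → a ∈ S → v ~ a → 1 ≤ degree v S
  degree-≥1 {v} {S = x ∷ xs} (here refl) v~x with v ~? x
  ... | yes _   = s≤s z≤n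
  ... | no ¬v~x = ⊥-elim (¬v~x v~x)
  degree-≥1 {v} {S = x ∷ xs} (there a∈) v~a = ≤-trans (degree-≥1 a∈ v~a) (m≤n+m _ (edge v x))

  degree-≥2 : ∀ {v a b S} → a ∈ S → b ∈ S → a ≢ b → v ~ a → v ~ b → 2 ≤ degree v S
  degree-≥2 (here refl) (here refl) a≢b _ _ = ⊥-elim (a≢b refl)
  degree-≥2 {v} {S = x ∷ xs} (here refl) (there b∈) _ v~x v~b with v ~? x
  ... | yes _   = s≤s (degree-≥1 b∈ v~b)
  ... | no ¬v~x = ⊥-elim (¬v~x v~x)
  degree-≥2 {v} {S = x ∷ xs} (there a∈) (here refl) _ v~a v~x with v ~? x
  ... | yes _   = s≤s (degree-≥1 a∈ v~a)
  ... | no ¬v~x = ⊥-elim (¬v~x v~x)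
  degree-≥2 {v} {S = x ∷ xs} (there a∈) (there b∈) a≢b v~a v~b =
    ≤-trans (degree-≥2 a∈ b∈ a≢b v~a v~b) (m≤n+m _ (edge v x))

  cycleAt-degree≥2 : ∀ {x xs} ws → Cycle (x ∷ ws) → All (_∈ x ∷ xs) ws → 2 ≤ degree x xs
  cycleAt-degree≥2 []       (_ , s≤s () , _) _
  cycleAt-degree≥2 (_ ∷ []) (_ , s≤s (s≤s ()) , _) _
  cycleAt-degree≥2 (a ∷ b₀ ∷ ws) (x≢ ∷ a≢ ∷ _ , _ , x~a ∷ _ ∷ lnk) (a∈ ∷ ws∈)
    with Linked-last b₀ ws lnk
  ... | b , b∈ , b~x =
    degree-≥2 (Any.tail (≢-sym (All.lookup x≢ (here refl))) a∈)
              (Any.tail (≢-sym (All.lookup x≢ (there b∈))) (All.lookup ws∈ b∈))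
              (All.lookup a≢ b∈) x~a (~-sym b~x)

  cycle-degree≥2 : ∀ {x xs c} → Cycle c → x ∈ c → All (_∈ x ∷ xs) c → 2 ≤ degree x xs
  cycle-degree≥2 {x} cyc x∈c c⊆ with ∈-∃++ x∈c
  ... | pre , post , refl =
    cycleAt-degree≥2 (post ++ pre) (Cycle-rotate-to pre x post cyc)
      (All.tail (All-resp-↭ (rotation-↭ pre x post) c⊆))

  EliminationOrder : List A → Set
  EliminationOrder []       = ⊤
  EliminationOrder (x ∷ xs) = degree x xs ≤ 1 × EliminationOrder xs

  eliminationOrder-acyclic : ∀ F → EliminationOrder F → ∀ {c} → Cycle c → ¬ All (_∈ F) c
  eliminationOrder-acyclic []       _ {[]}    ()
  eliminationOrder-acyclic []       _ {_ ∷ _} _ (() ∷ _)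
  eliminationOrder-acyclic (x ∷ xs) (deg≤1 , order) {c} cyc c⊆F with x ∈? c
  ... | yes x∈c = 1+n≰n (≤-trans (cycle-degree≥2 cyc x∈c c⊆F) deg≤1)
  ... | no  x∉c = eliminationOrder-acyclic xs order cyc
                    (All.tabulate λ y∈c → Any.tail (λ { refl → x∉c y∈c }) (All.lookup c⊆F y∈c))

  eliminationOrder? : ∀ F → Dec (EliminationOrder F)
  eliminationOrder? []       = yes tt
  eliminationOrder? (x ∷ xs) = degree x xs ≤? 1 ×-dec eliminationOrder? xs

  arcs-comm : ∀ X Y → arcs X Y ≡ arcs Y X
  arcs-comm X Y = trans (∑-comm X Y edge) (∑-cong Y λ {y} _ → ∑-cong X λ {x} _ → edge-sym x y)

  arcs-partition : ∀ {P : A → Set} (P? : U.Decidable P) X Y →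
                   arcs X Y ≡ arcs X (filter P? Y) + arcs X (filter (¬? ∘ P?) Y)
  arcs-partition P? X Y = trans (∑-cong X λ {u} _ → ∑-partition P? Y (edge u)) (∑-+ X _ _)

  neighbour : ∀ {v} S → 1 ≤ degree v S → ∃[ w ] w ∈ S × v ~ w
  neighbour {v} (x ∷ xs) deg≥1 with v ~? x
  ... | yes v~x = x , here refl , v~x
  ... | no  _   = let w , w∈ , v~w = neighbour xs deg≥1 in w , there w∈ , v~w

  degree-remove : ∀ {S} v p → Unique S → degree v S ≤ suc (degree v (remove p S))
  degree-remove {S} v p unique with p ∈? S
  ... | yes p∈S = ≤-trans (≤-reflexive (∑-remove unique p∈S (edge v))) (+-monoˡ-≤ _ (edge≤1 v p))
  ... | no  p∉S = ≤-trans (≤-reflexive (cong (degree v) (sym (filter-all (λ x → ¬? (x ≟ p)) p-free))))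
                          (n≤1+n _)
    where
    p-free : All (λ x → ¬ x ≡ p) S
    p-free = All.tabulate λ x∈S → λ { refl → p∉S x∈S }

  neighbour-≢ : ∀ {v S} → Unique S → 2 ≤ degree v S → ∀ p → ∃[ w ] w ∈ S × v ~ w × w ≢ p
  neighbour-≢ {v} {S} unique deg≥2 p =
    let w , w∈ , v~w = neighbour (remove p S) (≤-pred (≤-trans deg≥2 (degree-remove v p unique)))
        w∈S , w≢p    = ∈-remove⁻ S w∈
    in w , w∈S , v~w , w≢p

  module Loopless (~-irrefl : ∀ {u} → ¬ u ~ u) where

    edge-irrefl : ∀ u → edge u u ≡ 0
    edge-irrefl u with u ~? u
    ... | yes u~u = ⊥-elim (~-irrefl u~u)
    ... | no  _   = refl

    degree-remove-self : ∀ {v S} → Unique S → v ∈ S → degree v S ≡ degree v (remove v S)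
    degree-remove-self {v} {S} unique v∈S =
      trans (∑-remove unique v∈S (edge v)) (cong (_+ degree v (remove v S)) (edge-irrefl v))

    arcs-remove : ∀ {v S} → Unique S → v ∈ S →
                  let S′ = remove v S in arcs S S ≡ degree v S′ + (degree v S′ + arcs S′ S′)
    arcs-remove {v} {S} unique v∈S = begin
      arcs S S
        ≡⟨ ∑-remove unique v∈S (λ u → degree u S) ⟩
      degree v S + ∑ S′ (λ u → degree u S)
        ≡⟨ cong₂ _+_ (degree-remove-self unique v∈S) (∑-cong S′ λ {u} _ → ∑-remove unique v∈S (edge u)) ⟩
      degree v S′ + ∑ S′ (λ u → edge u v + degree u S′)
        ≡⟨ cong (degree v S′ +_) (∑-+ S′ (λ u → edge u v) (λ u → degree u S′)) ⟩
      degree v S′ + (∑ S′ (λ u → edge u v) + arcs S′ S′)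
        ≡⟨ cong (λ t → degree v S′ + (t + arcs S′ S′)) (∑-cong S′ λ {u} _ → edge-sym u v) ⟩
      degree v S′ + (degree v S′ + arcs S′ S′)
        ∎
      where
      open ≡-Reasoning
      S′ : List A
      S′ = remove v S

    takeThrough : A → List A → List A
    takeThrough w []       = []
    takeThrough w (x ∷ xs) with x ≟ w
    ... | yes _ = x ∷ []
    ... | no  _ = x ∷ takeThrough w xs

    takeThrough-All : ∀ {P : A → Set} w xs → All P xs → All P (takeThrough w xs)
    takeThrough-All w []       []         = []
    takeThrough-All w (x ∷ xs) (px ∷ pxs) with x ≟ w
    ... | yes _ = px ∷ []
    ... | no  _ = px ∷ takeThrough-All w xs pxs

    takeThrough-Unique : ∀ w xs → Unique xs → Unique (takeThrough w xs)
    takeThrough-Unique w []       []             = []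
    takeThrough-Unique w (x ∷ xs) (x≢ ∷ unique) with x ≟ w
    ... | yes _ = [] ∷ []
    ... | no  _ = takeThrough-All w xs x≢ ∷ takeThrough-Unique w xs unique

    takeThrough-Linked : ∀ {w y z} xs → w ∈ xs → Linked _~_ (y ∷ xs) → w ~ z →
                         Linked _~_ (y ∷ takeThrough w xs ++ z ∷ [])
    takeThrough-Linked {w} (x ∷ xs) w∈ (y~x ∷ lnk) w~z with x ≟ w
    takeThrough-Linked (x ∷ xs) _           (y~x ∷ lnk) x~z | yes refl = y~x ∷ x~z ∷ [-]
    takeThrough-Linked (x ∷ xs) (here refl) (y~x ∷ lnk) w~z | no  x≢w  = ⊥-elim (x≢w refl)
    takeThrough-Linked (x ∷ xs) (there w∈)  (y~x ∷ lnk) w~z | no  _    =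
      y~x ∷ takeThrough-Linked xs w∈ lnk w~z

    length-takeThrough : ∀ w x xs → 1 ≤ length (takeThrough w (x ∷ xs))
    length-takeThrough w x xs with x ≟ w
    ... | yes _ = s≤s z≤n
    ... | no  _ = s≤s z≤n

    close-path : ∀ {h q w} rest → Unique (h ∷ q ∷ rest) → Linked _~_ (h ∷ q ∷ rest) →
                 w ∈ rest → w ~ h → Cycle (h ∷ q ∷ takeThrough w rest)
    close-path {w = w} rest@(x ∷ xs) ((h≢q ∷ h≢rest) ∷ q≢rest ∷ unique) (h~q ∷ lnk) w∈ w~h =
      ((h≢q ∷ takeThrough-All w rest h≢rest) ∷ takeThrough-All w rest q≢rest ∷
         takeThrough-Unique w rest unique) ,
      s≤s (s≤s (length-takeThrough w x xs)) ,
      h~q ∷ takeThrough-Linked rest w∈ lnk w~h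

    -- The path h ∷ q ∷ rest is stored most recent vertex first; its vertices are distinct
    -- and lie in S, so it cannot outgrow S and the fuel never runs out.
    extend-path : ∀ {S} → Unique S → (∀ {v} → v ∈ S → 2 ≤ degree v S) →
                  ∀ fuel h q rest → length S < length (h ∷ q ∷ rest) + fuel →
                  Unique (h ∷ q ∷ rest) → All (_∈ S) (h ∷ q ∷ rest) → Linked _~_ (h ∷ q ∷ rest) →
                  CycleIn S
    extend-path {S} _ _ zero h q rest room unique path⊆S _ =
      ⊥-elim (<⇒≱ (subst (length S <_) (+-identityʳ _) room) (unique-⊆⇒length≤ unique path⊆S))
    extend-path {S} uS minDeg (suc fuel) h q rest room unique path⊆S@(h∈S ∷ q∈S ∷ rest⊆S) lnk
      with neighbour-≢ uS (minDeg h∈S) q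
    ... | w , w∈S , h~w , w≢q with w ∈? rest
    ...   | yes w∈rest =
      h ∷ q ∷ takeThrough w rest , close-path rest unique lnk w∈rest (~-sym h~w) ,
      h∈S ∷ q∈S ∷ takeThrough-All w rest rest⊆S
    ...   | no  w∉rest =
      extend-path uS minDeg fuel w h (q ∷ rest) (subst (length S <_) (+-suc _ fuel) room)
        (w-fresh ∷ unique) (w∈S ∷ path⊆S) (~-sym h~w ∷ lnk)
      where
      w-fresh : All (w ≢_) (h ∷ q ∷ rest)
      w-fresh = (λ { refl → ~-irrefl h~w }) ∷ w≢q ∷ All.tabulate λ y∈rest → λ { refl → w∉rest y∈rest }

    minDegree2⇒cycle : ∀ {S} → Unique S → 1 ≤ length S → (∀ {v} → v ∈ S → 2 ≤ degree v S) → CycleIn S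
    minDegree2⇒cycle {v ∷ S} uS _ minDeg
      with neighbour (v ∷ S) (≤-trans (n≤1+n 1) (minDeg (here refl)))
    ... | w , w∈ , v~w =
      extend-path uS minDeg (length (v ∷ S)) w v [] (m<n+m (length (v ∷ S)) {2} (s≤s z≤n))
        ((w≢v ∷ []) ∷ [] ∷ []) (w∈ ∷ here refl ∷ []) (~-sym v~w ∷ [-])
      where
      w≢v : w ≢ v
      w≢v = λ { refl → ~-irrefl v~w }

    -- arcs S S counts every edge twice, so a dense S spans at least as many edges as vertices.
    Dense : List A → Set
    Dense S = 1 ≤ length S × length S + length S ≤ arcs S S

    Dense-remove-leaf : ∀ {v S} → Unique S → v ∈ S → degree v S ≤ 1 → Dense S → Dense (remove v S)
    Dense-remove-leaf {v} {S} unique v∈S deg≤1 (_ , dense) =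
      nonempty S′ bound , leaf-bound deg′≤1 bound
      where
      S′ : List A
      S′ = remove v S
      deg′≤1 : degree v S′ ≤ 1
      deg′≤1 = subst (_≤ 1) (degree-remove-self unique v∈S) deg≤1
      bound : suc (length S′) + suc (length S′) ≤ degree v S′ + (degree v S′ + arcs S′ S′)
      bound = ≤-trans (+-mono-≤ (length-remove< v∈S) (length-remove< v∈S))
                      (subst (length S + length S ≤_) (arcs-remove unique v∈S) dense)
      nonempty : ∀ xs → suc (length xs) + suc (length xs) ≤ degree v xs + (degree v xs + arcs xs xs) →
                 1 ≤ length xs
      nonempty []      ()
      nonempty (_ ∷ _) _ = s≤s z≤n

    dense⇒cycle : ∀ {S} → Unique S → Dense S → CycleIn S
    dense⇒cycle {S} = prune (length S) ≤-refl
      where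
      prune : ∀ {U} n → length U ≤ n → Unique U → Dense U → CycleIn U
      prune zero    len≤0 _ (u≥1 , _) = ⊥-elim (1+n≰n (≤-trans u≥1 len≤0))
      prune {U} (suc n) len≤n unique dense with Any.any? (λ v → degree v U ≤? 1) U
      ... | no ¬leaf =
        minDegree2⇒cycle unique (proj₁ dense) λ v∈U → ≰⇒> (All.lookup (¬Any⇒All¬ U ¬leaf) v∈U)
      ... | yes leaf with find leaf
      ...   | v , v∈U , deg≤1
        with prune n (≤-pred (≤-trans (length-remove< v∈U) len≤n))
                   (Unique.filter⁺ _ unique) (Dense-remove-leaf unique v∈U deg≤1 dense)
      ...     | c , cyc , c⊆ = c , cyc , All.map (proj₁ ∘ ∈-remove⁻ U) c⊆

    regular-complement-cycle : ∀ {P d} (D : List A) → Unique P → (∀ {v} → v ∈ P → degree v P ≡ d) →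
      let S = filter (_∉? D) P ; X = filter (_∈? D) P in
      1 ≤ length S → length S + length S + d * length X ≤ d * length S → CycleIn S
    regular-complement-cycle {P} {d} D unique regular s≥1 bound =
      dense⇒cycle (Unique.filter⁺ _ unique) (s≥1 , dense)
      where
      open ≤-Reasoning
      S X : List A
      S = filter (_∉? D) P
      X = filter (_∈? D) P
      arcs-regular : ∀ {Y} → All (_∈ P) Y → arcs Y P ≡ d * length Y
      arcs-regular {Y} Y⊆P = trans (∑-cong Y λ y∈Y → regular (All.lookup Y⊆P y∈Y)) (∑-const Y d)
      S⊆P : All (_∈ P) S
      S⊆P = All.tabulate λ v∈S → proj₁ (∈-filter⁻ (_∉? D) {xs = P} v∈S)
      X⊆P : All (_∈ P) X
      X⊆P = All.tabulate λ v∈X → proj₁ (∈-filter⁻ (_∈? D) {xs = P} v∈X)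
      arcs-S-X : arcs S X ≤ d * length X
      arcs-S-X = begin
        arcs S X             ≡⟨ arcs-comm S X ⟩
        arcs X S             ≤⟨ m≤n+m (arcs X S) (arcs X X) ⟩
        arcs X X + arcs X S  ≡⟨ arcs-partition (_∈? D) X P ⟨
        arcs X P             ≡⟨ arcs-regular X⊆P ⟩
        d * length X         ∎
      dense : length S + length S ≤ arcs S S
      dense = +-cancelʳ-≤ (d * length X) (length S + length S) (arcs S S) (begin
        length S + length S + d * length X  ≤⟨ bound ⟩
        d * length S                        ≡⟨ arcs-regular S⊆P ⟨
        arcs S P                            ≡⟨ arcs-partition (_∈? D) S P ⟩
        arcs S X + arcs S S                 ≤⟨ +-monoˡ-≤ (arcs S S) arcs-S-X ⟩
        d * length X + arcs S S             ≡⟨ +-comm (d * length X) (arcs S S) ⟩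
        arcs S S + d * length X             ∎)

module _ {n : ℕ} where

  swap-lookupʲ : ∀ (i j : Fin n) u → lookup (swap i j u) j ≡ lookup u i
  swap-lookupʲ i j u = lookup∘update j (u [ i ]≔ lookup u j) (lookup u i)

  swap-lookupⁱ : ∀ (i j : Fin n) u → i ≢ j → lookup (swap i j u) i ≡ lookup u j
  swap-lookupⁱ i j u i≢j =
    trans (lookup∘update′ i≢j (u [ i ]≔ lookup u j) (lookup u i)) (lookup∘update i u (lookup u j))

  swap-lookup-other : ∀ (i j k : Fin n) u → k ≢ i → k ≢ j → lookup (swap i j u) k ≡ lookup u k
  swap-lookup-other i j k u k≢i k≢j =
    trans (lookup∘update′ k≢j (u [ i ]≔ lookup u j) (lookup u i)) (lookup∘update′ k≢i u (lookup u j))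

  swap-swap-lookup : ∀ (i j k : Fin n) u → lookup (swap i j (swap i j u)) k ≡ lookup u k
  swap-swap-lookup i j k u with k Fin.≟ j | k Fin.≟ i
  ... | yes refl | yes refl = trans (swap-lookupʲ k k (swap k k u)) (swap-lookupʲ k k u)
  ... | yes refl | no  k≢i  = trans (swap-lookupʲ i k (swap i k u)) (swap-lookupⁱ i k u (≢-sym k≢i))
  ... | no  k≢j  | yes refl = trans (swap-lookupⁱ k j (swap k j u) k≢j) (swap-lookupʲ k j u)
  ... | no  k≢j  | no  k≢i  =
    trans (swap-lookup-other i j k (swap i j u) k≢i k≢j) (swap-lookup-other i j k u k≢i k≢j)

  swap-involutive : ∀ (i j : Fin n) (u : Word n) → swap i j (swap i j u) ≡ u
  swap-involutive i j u = begin
    swap i j (swap i j u)                     ≡⟨ tabulate∘lookup _ ⟨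
    tabulate (lookup (swap i j (swap i j u))) ≡⟨ tabulate-cong (λ k → swap-swap-lookup i j k u) ⟩
    tabulate (lookup u)                       ≡⟨ tabulate∘lookup u ⟩
    u                                         ∎
    where open ≡-Reasoning

InT? : ∀ {n} (i j : Fin n) → Dec (InT i j)
InT? i j = (toℕ i ℕ.≟ 0 ×-dec 0 ℕ.<? toℕ j) ⊎-dec (1 ℕ.≤? toℕ i ×-dec toℕ j ℕ.≟ suc (toℕ i))

vectors : ∀ n m → List (Vec (Fin n) m)
vectors n zero    = [] ∷ []
vectors n (suc m) = cartesianProductWith _∷_ (allFin n) (vectors n m)

∈-vectors : ∀ {n m} (v : Vec (Fin n) m) → v ∈ vectors n m
∈-vectors []      = here refl
∈-vectors (a ∷ v) = ∈-cartesianProductWith⁺ _∷_ (∈-allFin a) (∈-vectors v)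

isPerm? : ∀ {n} (u : Word n) → Dec (IsPerm u)
isPerm? u = unique? Fin._≟_ (toList u)

module BubbleSortStar (n : ℕ) (T : List (Fin n × Fin n))
                      (T-spec : T ≡ filter (uncurry InT?) (cartesianProduct (allFin n) (allFin n))) where

  _≟ʷ_ : DecidableEquality (Word n)
  _≟ʷ_ = Vec.≡-dec Fin._≟_

  open import Data.List.Membership.DecPropositional _≟ʷ_ using (_∈?_; _∉?_)

  T-sound : ∀ {i j} → (i , j) ∈ T → InT i j
  T-sound ij∈T = proj₂ (∈-filter⁻ (uncurry InT?) {xs = cartesianProduct (allFin n) (allFin n)}
                                  (subst ((_ , _) ∈_) T-spec ij∈T))

  T-complete : ∀ {i j} → InT i j → (i , j) ∈ T
  T-complete {i} {j} inT =
    subst ((i , j) ∈_) (sym T-spec)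
      (∈-filter⁺ (uncurry InT?) (∈-cartesianProduct⁺ (∈-allFin i) (∈-allFin j)) inT)

  _⇄_ : Word n → Word n → Set
  u ⇄ v = Any (λ (i , j) → v ≡ swap i j u) T

  _⇄?_ : Decidable _⇄_
  u ⇄? v = Any.any? (λ (i , j) → v ≟ʷ swap i j u) T

  ⇄-sym : Symmetric _⇄_
  ⇄-sym {u} = Any.map λ { {i , j} refl → sym (swap-involutive i j u) }

  Adj⇒⇄ : ∀ {u v} → Adj u v → u ⇄ v
  Adj⇒⇄ (i , j , inT , refl) = Any.map (λ { refl → refl }) (T-complete inT)

  ⇄⇒Adj : ∀ {u v} → u ⇄ v → Adj u v
  ⇄⇒Adj u⇄v with find u⇄v
  ... | (i , j) , ij∈T , v≡ = i , j , T-sound ij∈T , v≡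

  -- BS_n has no loops anyway, but excluding them explicitly supplies the irreflexivity that
  -- the cycle-finding argument assumes.
  _—_ : Word n → Word n → Set
  u — v = u ⇄ v × u ≢ v

  _—?_ : Decidable _—_
  u —? v = u ⇄? v ×-dec ¬? (u ≟ʷ v)

  —-sym : Symmetric _—_
  —-sym (u⇄v , u≢v) = ⇄-sym u⇄v , ≢-sym u≢v

  module Swaps  = FiniteGraph _≟ʷ_ _⇄?_ ⇄-sym
  module Simple = FiniteGraph _≟ʷ_ _—?_ —-sym
  open Simple.Loopless (λ (_ , u≢u) → u≢u refl) using (regular-complement-cycle)

  open Removal _≟ʷ_ using (unique-⊆⇒length≤)

  -- D is the decycling set, of size k + 1, F an elimination order of the other vertices, d the
  -- degree of BS_n, and s₀ = |P| − k the number of vertices left outside a set of size k.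
  Certificate : (P D F : List (Word n)) (d s₀ k : ℕ) → Set
  Certificate P D F d s₀ k =
    IsVertexSet n D × length D ≡ suc k × All (λ w → w ∈ D ⊎ w ∈ F) P × Swaps.EliminationOrder F ×
    Unique P × All (λ v → Simple.degree v P ≡ d) P ×
    1 ≤ d × 1 ≤ s₀ × s₀ + k ≡ length P × s₀ + s₀ + d * k ≤ d * s₀

  certificate? : ∀ P D F d s₀ k → Dec (Certificate P D F d s₀ k)
  certificate? P D F d s₀ k =
    (all? isPerm? D ×-dec unique? _≟ʷ_ D) ×-dec length D ℕ.≟ suc k ×-dec
    all? (λ w → w ∈? D ⊎-dec w ∈? F) P ×-dec Swaps.eliminationOrder? F ×-dec
    unique? _≟ʷ_ P ×-dec all? (λ v → Simple.degree v P ℕ.≟ d) P ×-dec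
    1 ≤? d ×-dec 1 ≤? s₀ ×-dec s₀ + k ℕ.≟ length P ×-dec s₀ + s₀ + d * k ≤? d * s₀


  module _ {P : List (Word n)} (P-spec : P ≡ filter isPerm? (vectors n n)) where

    perm⇒∈P : ∀ {w} → IsPerm w → w ∈ P
    perm⇒∈P {w} perm = subst (w ∈_) (sym P-spec) (∈-filter⁺ isPerm? (∈-vectors w) perm)

    ∈P⇒perm : ∀ {w} → w ∈ P → IsPerm w
    ∈P⇒perm w∈P = proj₂ (∈-filter⁻ isPerm? {xs = vectors n n} (subst (_ ∈_) P-spec w∈P))

    Simple-cycle⇒IsCycle : ∀ {c} → Simple.Cycle c → All (_∈ P) c → IsCycle c
    Simple-cycle⇒IsCycle {_ ∷ _} (unique , len , lnk) c⊆P =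
      All.map ∈P⇒perm c⊆P , unique , len , Linked.map (⇄⇒Adj ∘ proj₁) lnk

    eliminationOrder⇒decycling : ∀ {D} F → All (λ w → w ∈ D ⊎ w ∈ F) P → Swaps.EliminationOrder F →
                                 IsDecyclingSet n D
    eliminationOrder⇒decycling F cover order (v ∷ vs) (perm , unique , len , lnk) avoidsD =
      Swaps.eliminationOrder-acyclic F order (unique , len , Linked.map Adj⇒⇄ lnk)
        (All.zipWith (λ (p , w∉D) → [ flip contradiction w∉D , id ]′ (All.lookup cover (perm⇒∈P p)))
                     (perm , avoidsD))

    complement-cycle⇒¬decycling : ∀ {D} → Simple.CycleIn (filter (_∉? D) P) → ¬ IsDecyclingSet n D
    complement-cycle⇒¬decycling {D} (c , cyc , c⊆S) decycling =
      decycling c (Simple-cycle⇒IsCycle cyc (All.map (proj₁ ∘ ∈S⁻) c⊆S)) (All.map (proj₂ ∘ ∈S⁻) c⊆S)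
      where
      ∈S⁻ : ∀ {v} → v ∈ filter (_∉? D) P → v ∈ P × v ∉ D
      ∈S⁻ = ∈-filter⁻ (_∉? D) {xs = P}

    decycling-length≥ : ∀ {d s₀ k D} → Unique P → All (λ v → Simple.degree v P ≡ d) P →
                        1 ≤ d → 1 ≤ s₀ → s₀ + k ≡ length P → s₀ + s₀ + d * k ≤ d * s₀ →
                        IsDecyclingSet n D → suc k ≤ length D
    decycling-length≥ {d} {s₀} {k} {D} unique regular d≥1 s₀≥1 s₀+k≡N bound decycling
      with length D ℕ.≤? k
    ... | no  D≰k = ≰⇒> D≰k
    ... | yes D≤k =
      contradiction decycling (complement-cycle⇒¬decycling
        (regular-complement-cycle D unique (All.lookup regular) (proj₁ dense) (proj₂ dense)))
      where
      S X : List (Word n)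
      S = filter (_∉? D) P
      X = filter (_∈? D) P
      x≤k : length X ≤ k
      x≤k = ≤-trans (unique-⊆⇒length≤ (Unique.filter⁺ _ unique)
                                       (All.tabulate λ v∈X → proj₂ (∈-filter⁻ (_∈? D) {xs = P} v∈X)))
                    D≤k
      s+x≡s₀+k : length S + length X ≡ s₀ + k
      s+x≡s₀+k = trans (+-comm (length S) (length X))
                       (trans (sym (length-partition (_∈? D) P)) (sym s₀+k≡N))
      dense : 1 ≤ length S × length S + length S + d * length X ≤ d * length S
      dense = dense-complement d≥1 s₀≥1 bound s+x≡s₀+k x≤k

    decyclingNumber : ∀ {D F d s₀ k} → Certificate P D F d s₀ k → DecyclingNumber n (suc k)
    decyclingNumber {D} {F}
      (vertexSet , |D| , cover , order , unique , regular , d≥1 , s₀≥1 , s₀+k≡N , bound) =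
      (D , vertexSet , eliminationOrder⇒decycling F cover order , |D|) ,
      λ _ _ → decycling-length≥ unique regular d≥1 s₀≥1 s₀+k≡N bound

w₃ : Fin 3 → Fin 3 → Fin 3 → Word 3
w₃ a b c = a ∷ b ∷ c ∷ []

w₄ : Fin 4 → Fin 4 → Fin 4 → Fin 4 → Word 4
w₄ a b c d = a ∷ b ∷ c ∷ d ∷ []

w₅ : Fin 5 → Fin 5 → Fin 5 → Fin 5 → Fin 5 → Word 5
w₅ a b c d e = a ∷ b ∷ c ∷ d ∷ e ∷ []

P₃ : List (Word 3)
P₃ =
    w₃ 0F 1F 2F ∷ w₃ 0F 2F 1F ∷ w₃ 1F 0F 2F ∷ w₃ 1F 2F 0F ∷ w₃ 2F 0F 1F ∷ w₃ 2F 1F 0F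
  ∷ []

D₃ : List (Word 3)
D₃ =
    w₃ 0F 2F 1F ∷ w₃ 2F 1F 0F
  ∷ []

F₃ : List (Word 3)
F₃ =
    w₃ 0F 1F 2F ∷ w₃ 1F 2F 0F ∷ w₃ 1F 0F 2F ∷ w₃ 2F 0F 1F
  ∷ []

P₄ : List (Word 4)
P₄ =
    w₄ 0F 1F 2F 3F ∷ w₄ 0F 1F 3F 2F ∷ w₄ 0F 2F 1F 3F ∷ w₄ 0F 2F 3F 1F ∷ w₄ 0F 3F 1F 2F
  ∷ w₄ 0F 3F 2F 1F ∷ w₄ 1F 0F 2F 3F ∷ w₄ 1F 0F 3F 2F ∷ w₄ 1F 2F 0F 3F ∷ w₄ 1F 2F 3F 0F
  ∷ w₄ 1F 3F 0F 2F ∷ w₄ 1F 3F 2F 0F ∷ w₄ 2F 0F 1F 3F ∷ w₄ 2F 0F 3F 1F ∷ w₄ 2F 1F 0F 3F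
  ∷ w₄ 2F 1F 3F 0F ∷ w₄ 2F 3F 0F 1F ∷ w₄ 2F 3F 1F 0F ∷ w₄ 3F 0F 1F 2F ∷ w₄ 3F 0F 2F 1F
  ∷ w₄ 3F 1F 0F 2F ∷ w₄ 3F 1F 2F 0F ∷ w₄ 3F 2F 0F 1F ∷ w₄ 3F 2F 1F 0F
  ∷ []

D₄ : List (Word 4)
D₄ =
    w₄ 0F 1F 2F 3F ∷ w₄ 0F 2F 3F 1F ∷ w₄ 0F 3F 1F 2F ∷ w₄ 1F 0F 3F 2F ∷ w₄ 1F 2F 0F 3F
  ∷ w₄ 1F 3F 2F 0F ∷ w₄ 2F 1F 3F 0F ∷ w₄ 3F 0F 2F 1F ∷ w₄ 3F 1F 0F 2F ∷ w₄ 3F 2F 1F 0F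
  ∷ []

F₄ : List (Word 4)
F₄ =
    w₄ 0F 1F 3F 2F ∷ w₄ 0F 2F 1F 3F ∷ w₄ 0F 3F 2F 1F ∷ w₄ 1F 0F 2F 3F ∷ w₄ 1F 2F 3F 0F
  ∷ w₄ 1F 3F 0F 2F ∷ w₄ 2F 1F 0F 3F ∷ w₄ 2F 3F 1F 0F ∷ w₄ 3F 0F 1F 2F ∷ w₄ 2F 0F 1F 3F
  ∷ w₄ 2F 0F 3F 1F ∷ w₄ 2F 3F 0F 1F ∷ w₄ 3F 1F 2F 0F ∷ w₄ 3F 2F 0F 1F
  ∷ []

P₅ : List (Word 5)
P₅ =
    w₅ 0F 1F 2F 3F 4F ∷ w₅ 0F 1F 2F 4F 3F ∷ w₅ 0F 1F 3F 2F 4F ∷ w₅ 0F 1F 3F 4F 2F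
  ∷ w₅ 0F 1F 4F 2F 3F ∷ w₅ 0F 1F 4F 3F 2F ∷ w₅ 0F 2F 1F 3F 4F ∷ w₅ 0F 2F 1F 4F 3F
  ∷ w₅ 0F 2F 3F 1F 4F ∷ w₅ 0F 2F 3F 4F 1F ∷ w₅ 0F 2F 4F 1F 3F ∷ w₅ 0F 2F 4F 3F 1F
  ∷ w₅ 0F 3F 1F 2F 4F ∷ w₅ 0F 3F 1F 4F 2F ∷ w₅ 0F 3F 2F 1F 4F ∷ w₅ 0F 3F 2F 4F 1F
  ∷ w₅ 0F 3F 4F 1F 2F ∷ w₅ 0F 3F 4F 2F 1F ∷ w₅ 0F 4F 1F 2F 3F ∷ w₅ 0F 4F 1F 3F 2F
  ∷ w₅ 0F 4F 2F 1F 3F ∷ w₅ 0F 4F 2F 3F 1F ∷ w₅ 0F 4F 3F 1F 2F ∷ w₅ 0F 4F 3F 2F 1F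
  ∷ w₅ 1F 0F 2F 3F 4F ∷ w₅ 1F 0F 2F 4F 3F ∷ w₅ 1F 0F 3F 2F 4F ∷ w₅ 1F 0F 3F 4F 2F
  ∷ w₅ 1F 0F 4F 2F 3F ∷ w₅ 1F 0F 4F 3F 2F ∷ w₅ 1F 2F 0F 3F 4F ∷ w₅ 1F 2F 0F 4F 3F
  ∷ w₅ 1F 2F 3F 0F 4F ∷ w₅ 1F 2F 3F 4F 0F ∷ w₅ 1F 2F 4F 0F 3F ∷ w₅ 1F 2F 4F 3F 0F
  ∷ w₅ 1F 3F 0F 2F 4F ∷ w₅ 1F 3F 0F 4F 2F ∷ w₅ 1F 3F 2F 0F 4F ∷ w₅ 1F 3F 2F 4F 0F
  ∷ w₅ 1F 3F 4F 0F 2F ∷ w₅ 1F 3F 4F 2F 0F ∷ w₅ 1F 4F 0F 2F 3F ∷ w₅ 1F 4F 0F 3F 2F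
  ∷ w₅ 1F 4F 2F 0F 3F ∷ w₅ 1F 4F 2F 3F 0F ∷ w₅ 1F 4F 3F 0F 2F ∷ w₅ 1F 4F 3F 2F 0F
  ∷ w₅ 2F 0F 1F 3F 4F ∷ w₅ 2F 0F 1F 4F 3F ∷ w₅ 2F 0F 3F 1F 4F ∷ w₅ 2F 0F 3F 4F 1F
  ∷ w₅ 2F 0F 4F 1F 3F ∷ w₅ 2F 0F 4F 3F 1F ∷ w₅ 2F 1F 0F 3F 4F ∷ w₅ 2F 1F 0F 4F 3F
  ∷ w₅ 2F 1F 3F 0F 4F ∷ w₅ 2F 1F 3F 4F 0F ∷ w₅ 2F 1F 4F 0F 3F ∷ w₅ 2F 1F 4F 3F 0F
  ∷ w₅ 2F 3F 0F 1F 4F ∷ w₅ 2F 3F 0F 4F 1F ∷ w₅ 2F 3F 1F 0F 4F ∷ w₅ 2F 3F 1F 4F 0F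
  ∷ w₅ 2F 3F 4F 0F 1F ∷ w₅ 2F 3F 4F 1F 0F ∷ w₅ 2F 4F 0F 1F 3F ∷ w₅ 2F 4F 0F 3F 1F
  ∷ w₅ 2F 4F 1F 0F 3F ∷ w₅ 2F 4F 1F 3F 0F ∷ w₅ 2F 4F 3F 0F 1F ∷ w₅ 2F 4F 3F 1F 0F
  ∷ w₅ 3F 0F 1F 2F 4F ∷ w₅ 3F 0F 1F 4F 2F ∷ w₅ 3F 0F 2F 1F 4F ∷ w₅ 3F 0F 2F 4F 1F
  ∷ w₅ 3F 0F 4F 1F 2F ∷ w₅ 3F 0F 4F 2F 1F ∷ w₅ 3F 1F 0F 2F 4F ∷ w₅ 3F 1F 0F 4F 2F
  ∷ w₅ 3F 1F 2F 0F 4F ∷ w₅ 3F 1F 2F 4F 0F ∷ w₅ 3F 1F 4F 0F 2F ∷ w₅ 3F 1F 4F 2F 0F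
  ∷ w₅ 3F 2F 0F 1F 4F ∷ w₅ 3F 2F 0F 4F 1F ∷ w₅ 3F 2F 1F 0F 4F ∷ w₅ 3F 2F 1F 4F 0F
  ∷ w₅ 3F 2F 4F 0F 1F ∷ w₅ 3F 2F 4F 1F 0F ∷ w₅ 3F 4F 0F 1F 2F ∷ w₅ 3F 4F 0F 2F 1F
  ∷ w₅ 3F 4F 1F 0F 2F ∷ w₅ 3F 4F 1F 2F 0F ∷ w₅ 3F 4F 2F 0F 1F ∷ w₅ 3F 4F 2F 1F 0F
  ∷ w₅ 4F 0F 1F 2F 3F ∷ w₅ 4F 0F 1F 3F 2F ∷ w₅ 4F 0F 2F 1F 3F ∷ w₅ 4F 0F 2F 3F 1F
  ∷ w₅ 4F 0F 3F 1F 2F ∷ w₅ 4F 0F 3F 2F 1F ∷ w₅ 4F 1F 0F 2F 3F ∷ w₅ 4F 1F 0F 3F 2F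
  ∷ w₅ 4F 1F 2F 0F 3F ∷ w₅ 4F 1F 2F 3F 0F ∷ w₅ 4F 1F 3F 0F 2F ∷ w₅ 4F 1F 3F 2F 0F
  ∷ w₅ 4F 2F 0F 1F 3F ∷ w₅ 4F 2F 0F 3F 1F ∷ w₅ 4F 2F 1F 0F 3F ∷ w₅ 4F 2F 1F 3F 0F
  ∷ w₅ 4F 2F 3F 0F 1F ∷ w₅ 4F 2F 3F 1F 0F ∷ w₅ 4F 3F 0F 1F 2F ∷ w₅ 4F 3F 0F 2F 1F
  ∷ w₅ 4F 3F 1F 0F 2F ∷ w₅ 4F 3F 1F 2F 0F ∷ w₅ 4F 3F 2F 0F 1F ∷ w₅ 4F 3F 2F 1F 0F
  ∷ []

D₅ : List (Word 5)
D₅ =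
    w₅ 0F 1F 2F 4F 3F ∷ w₅ 0F 1F 3F 2F 4F ∷ w₅ 0F 1F 4F 3F 2F ∷ w₅ 0F 2F 1F 3F 4F
  ∷ w₅ 0F 2F 3F 4F 1F ∷ w₅ 0F 2F 4F 1F 3F ∷ w₅ 0F 3F 2F 1F 4F ∷ w₅ 0F 3F 4F 2F 1F
  ∷ w₅ 0F 4F 2F 3F 1F ∷ w₅ 0F 4F 3F 1F 2F ∷ w₅ 1F 0F 2F 3F 4F ∷ w₅ 1F 0F 3F 4F 2F
  ∷ w₅ 1F 0F 4F 2F 3F ∷ w₅ 1F 2F 0F 4F 3F ∷ w₅ 1F 2F 3F 0F 4F ∷ w₅ 1F 3F 0F 2F 4F
  ∷ w₅ 1F 3F 2F 4F 0F ∷ w₅ 1F 3F 4F 0F 2F ∷ w₅ 1F 4F 0F 3F 2F ∷ w₅ 1F 4F 2F 0F 3F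
  ∷ w₅ 2F 0F 4F 3F 1F ∷ w₅ 2F 1F 0F 3F 4F ∷ w₅ 2F 1F 3F 4F 0F ∷ w₅ 2F 1F 4F 0F 3F
  ∷ w₅ 2F 3F 0F 4F 1F ∷ w₅ 2F 3F 1F 0F 4F ∷ w₅ 2F 3F 4F 1F 0F ∷ w₅ 2F 4F 0F 1F 3F
  ∷ w₅ 2F 4F 1F 3F 0F ∷ w₅ 2F 4F 3F 0F 1F ∷ w₅ 3F 0F 1F 2F 4F ∷ w₅ 3F 0F 2F 4F 1F
  ∷ w₅ 3F 0F 4F 1F 2F ∷ w₅ 3F 1F 0F 4F 2F ∷ w₅ 3F 1F 4F 2F 0F ∷ w₅ 3F 2F 0F 1F 4F
  ∷ w₅ 3F 2F 1F 4F 0F ∷ w₅ 3F 2F 4F 0F 1F ∷ w₅ 3F 4F 0F 2F 1F ∷ w₅ 3F 4F 1F 0F 2F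
  ∷ w₅ 3F 4F 2F 1F 0F ∷ w₅ 4F 0F 1F 3F 2F ∷ w₅ 4F 0F 2F 1F 3F ∷ w₅ 4F 0F 3F 2F 1F
  ∷ w₅ 4F 1F 0F 2F 3F ∷ w₅ 4F 1F 2F 3F 0F ∷ w₅ 4F 1F 3F 0F 2F ∷ w₅ 4F 2F 1F 0F 3F
  ∷ w₅ 4F 2F 3F 1F 0F ∷ w₅ 4F 3F 0F 1F 2F ∷ w₅ 4F 3F 1F 2F 0F
  ∷ []

F₅ : List (Word 5)
F₅ =
    w₅ 0F 1F 2F 3F 4F ∷ w₅ 0F 1F 3F 4F 2F ∷ w₅ 0F 1F 4F 2F 3F ∷ w₅ 0F 2F 1F 4F 3F
  ∷ w₅ 0F 2F 3F 1F 4F ∷ w₅ 0F 3F 1F 2F 4F ∷ w₅ 0F 3F 2F 4F 1F ∷ w₅ 0F 3F 4F 1F 2F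
  ∷ w₅ 0F 4F 1F 3F 2F ∷ w₅ 0F 4F 2F 1F 3F ∷ w₅ 0F 4F 3F 2F 1F ∷ w₅ 1F 0F 2F 4F 3F
  ∷ w₅ 1F 0F 3F 2F 4F ∷ w₅ 1F 0F 4F 3F 2F ∷ w₅ 1F 2F 0F 3F 4F ∷ w₅ 1F 2F 3F 4F 0F
  ∷ w₅ 1F 2F 4F 0F 3F ∷ w₅ 1F 3F 0F 4F 2F ∷ w₅ 1F 3F 4F 2F 0F ∷ w₅ 1F 4F 0F 2F 3F
  ∷ w₅ 1F 4F 3F 0F 2F ∷ w₅ 2F 0F 3F 4F 1F ∷ w₅ 2F 0F 4F 1F 3F ∷ w₅ 2F 1F 0F 4F 3F
  ∷ w₅ 2F 1F 3F 0F 4F ∷ w₅ 2F 1F 4F 3F 0F ∷ w₅ 2F 3F 0F 1F 4F ∷ w₅ 2F 3F 1F 4F 0F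
  ∷ w₅ 2F 3F 4F 0F 1F ∷ w₅ 2F 4F 0F 3F 1F ∷ w₅ 2F 4F 1F 0F 3F ∷ w₅ 2F 4F 3F 1F 0F
  ∷ w₅ 3F 0F 2F 1F 4F ∷ w₅ 3F 0F 4F 2F 1F ∷ w₅ 3F 1F 0F 2F 4F ∷ w₅ 3F 1F 2F 4F 0F
  ∷ w₅ 3F 1F 4F 0F 2F ∷ w₅ 3F 2F 0F 4F 1F ∷ w₅ 3F 2F 1F 0F 4F ∷ w₅ 3F 2F 4F 1F 0F
  ∷ w₅ 3F 4F 0F 1F 2F ∷ w₅ 3F 4F 2F 0F 1F ∷ w₅ 4F 0F 2F 3F 1F ∷ w₅ 4F 0F 3F 1F 2F
  ∷ w₅ 2F 0F 3F 1F 4F ∷ w₅ 2F 0F 1F 3F 4F ∷ w₅ 4F 1F 0F 3F 2F ∷ w₅ 4F 1F 2F 0F 3F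
  ∷ w₅ 3F 1F 2F 0F 4F ∷ w₅ 1F 3F 2F 0F 4F ∷ w₅ 4F 1F 3F 2F 0F ∷ w₅ 4F 2F 0F 1F 3F
  ∷ w₅ 4F 2F 1F 3F 0F ∷ w₅ 4F 3F 0F 2F 1F ∷ w₅ 4F 3F 1F 0F 2F ∷ w₅ 0F 3F 1F 4F 2F
  ∷ w₅ 3F 0F 1F 4F 2F ∷ w₅ 2F 0F 1F 4F 3F ∷ w₅ 4F 0F 1F 2F 3F ∷ w₅ 0F 4F 1F 2F 3F
  ∷ w₅ 3F 4F 1F 2F 0F ∷ w₅ 1F 4F 3F 2F 0F ∷ w₅ 1F 4F 2F 3F 0F ∷ w₅ 1F 2F 4F 3F 0F
  ∷ w₅ 0F 2F 4F 3F 1F ∷ w₅ 4F 2F 0F 3F 1F ∷ w₅ 4F 2F 3F 0F 1F ∷ w₅ 4F 3F 2F 0F 1F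
  ∷ w₅ 4F 3F 2F 1F 0F
  ∷ []

module BS₃ = BubbleSortStar 3 ((0F , 1F) ∷ (0F , 2F) ∷ (1F , 2F) ∷ []) refl
module BS₄ = BubbleSortStar 4 ((0F , 1F) ∷ (0F , 2F) ∷ (0F , 3F) ∷ (1F , 2F) ∷ (2F , 3F) ∷ []) refl
module BS₅ = BubbleSortStar 5
  ((0F , 1F) ∷ (0F , 2F) ∷ (0F , 3F) ∷ (0F , 4F) ∷ (1F , 2F) ∷ (2F , 3F) ∷ (3F , 4F) ∷ []) refl

decyclingNumber₃ : DecyclingNumber 3 2
decyclingNumber₃ = BS₃.decyclingNumber refl (from-yes (BS₃.certificate? P₃ D₃ F₃ 3 5 1))

decyclingNumber₄ : DecyclingNumber 4 10
decyclingNumber₄ = BS₄.decyclingNumber refl (from-yes (BS₄.certificate? P₄ D₄ F₄ 5 15 9))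

decyclingNumber₅ : DecyclingNumber 5 51
decyclingNumber₅ = BS₅.decyclingNumber refl (from-yes (BS₅.certificate? P₅ D₅ F₅ 7 70 50))

theorem3p8 : DecyclingNumber 3 2 × DecyclingNumber 4 10 × DecyclingNumber 5 51
theorem3p8 = decyclingNumber₃ , decyclingNumber₄ , decyclingNumber₅
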